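{- Let $h$ be a height function and $(n_0,i_0,j_0)\in\mathcal{U}$. Then the graph $G_{(n_0,i_0,j_0)}$ (its vertices and edges) is connected.
   Context: A height function is $h\colon\mathbb{Z}^2\to\mathbb{Z}$ with $|h(i_1,j_1)-h(i_2,j_2)|=1$ whenever $|i_1-i_2|+|j_1-j_2|=1$ (lattice-adjacent), $h(i,j)\equiv i+j\pmod 2$, and $h(i,j)+|i|+|j|\to\infty$ as $|i|+|j|\to\infty$. $\mathcal{U}=\{(n,i,j)\in\mathbb{Z}^3: n\equiv i+j \pmod 2,\ n>h(i,j)\}$. Crosses-and-wrenches graph $\mathcal{G}$ of $h$: an infinite planar graph with faces indexed by $\mathbb{Z}^2$. For each $(i,j)$ consider the block $\{(i,j),(i+1,j),(i,j+1),(i+1,j+1)\}$ with diagonal pairs $\{(i,j),(i+1,j+1)\}$ and $\{(i+1,j),(i,j+1)\}$. If both pairs have equal heights (a cross), the block contributes one vertex incident to all four faces of the block; otherwise exactly one pair $\{P,P'\}$ has equal heights (a wrench), and writing $\{Q,Q'\}$ for the other pair the block contributes two vertices $u_Q$ (incident to $P,P',Q$) and $u_{Q'}$ (incident to $P,P',Q'$) joined by a diagonal edge separating $P$ from $P'$. For lattice-adjacent faces $F,F'$, each of the two blocks containing both has a unique vertex incident to both, and $\mathcal{G}$ has an edge joining these two vertices, separating $F$ from $F'$. These are all the edges. The boundary edges of face $(i,j)$ are the four edges separating it from $(i\pm1,j),(i,j\pm1)$ and the diagonal edges of the wrench blocks in which $(i,j)$ is in the equal-height pair. For $(n_0,i_0,j_0)\in\mathcal{U}$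 let $p(i,j)=n_0-|i-i_0|-|j-j_0|$. The graph $G_{(n_0,i_0,j_0)}$ has as closed faces the faces $(i,j)$ with $h(i,j)<p(i,j)$, as edges the edges of $\mathcal{G}$ on the boundary of at least one closed face, and as vertices the endpoints of these edges. -}

module Defs where

open import Data.Integer using (ℤ; +_; _+_; _-_; ∣_∣; _≤_; _<_; _≟_)
open import Data.Integer.Divisibility using (_∣_)
import Data.Nat as ℕ
open import Data.Product using (Σ; ∃; _×_; _,_; proj₁; proj₂)
open import Data.Sum using (_⊎_)
open import Data.Empty using (⊥)
open import Data.Bool using (Bool; true; false; if_then_else_)
open import Relation.Nullary using (yes; no)
open import Relation.Binary.PropositionalEquality using (_≡_)

record IsHeightFunction (h : ℤ → ℤ → ℤ) : Set where
  field
    adjHor : ∀ i j → ∣ h (i + + 1) j - h i j ∣ ≡ 1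
    adjVer : ∀ i j → ∣ h i (j + + 1) - h i j ∣ ≡ 1
    parity : ∀ i j → + 2 ∣ (h i j - (i + j))
    growth : ∀ (M : ℤ) → ∃ λ (R : ℕ.ℕ) → ∀ i j →
             R ℕ.≤ ∣ i ∣ ℕ.+ ∣ j ∣ → M ≤ h i j + + ∣ i ∣ + + ∣ j ∣

InU : (h : ℤ → ℤ → ℤ) → ℤ → ℤ → ℤ → Set
InU h n i j = (+ 2 ∣ (n - (i + j))) × (h i j < n)

data Corner : Set where
  c00 c10 c01 c11 : Corner

cornerFace : ℤ → ℤ → Corner → ℤ × ℤ
cornerFace a b c00 = a , b
cornerFace a b c10 = a + + 1 , b
cornerFace a b c01 = a , b + + 1
cornerFace a b c11 = a + + 1 , b + + 1

onMain : Corner → Bool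
onMain c00 = true
onMain c11 = true
onMain c10 = false
onMain c01 = false

-- crossB: both diagonal pairs equal; mainW: only {c00,c11} equal;
-- antiW: {c10,c01} equal (the only remaining case for height functions)
data BlockType : Set where
  crossB mainW antiW : BlockType

blockType : (ℤ → ℤ → ℤ) → ℤ → ℤ → BlockType
blockType h a b with h a b ≟ h (a + + 1) (b + + 1) | h (a + + 1) b ≟ h a (b + + 1)
... | yes _ | yes _ = crossB
... | yes _ | no _  = mainW
... | no _  | _     = antiW

-- Vertices of 𝒢: the cross vertex of a block, or the wrench vertex u_Q
-- of a block, labelled by the corner Q (in the unequal pair).
data Vtx : Set where
  cross  : ℤ → ℤ → Vtx
  wrench : ℤ → ℤ → Corner → Vtx

-- the unique vertex of block (a,b) incident to the two adjacent corners k, k'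
blockVertex : (ℤ → ℤ → ℤ) → ℤ → ℤ → Corner → Corner → Vtx
blockVertex h a b k k' with blockType h a b
... | crossB = cross a b
... | mainW  = wrench a b (if onMain k then k' else k)
... | antiW  = wrench a b (if onMain k then k else k')

-- Edge labels of 𝒢:
--   hor i j : separates faces (i,j) and (i+1,j)
--   ver i j : separates faces (i,j) and (i,j+1)
--   diag a b : the diagonal edge of wrench block (a,b)
data Edge : Set where
  hor ver diag : ℤ → ℤ → Edge

ends : (ℤ → ℤ → ℤ) → Edge → Vtx × Vtx
ends h (hor i j) = blockVertex h i j c00 c10 , blockVertex h i (j - + 1) c01 c11
ends h (ver i j) = blockVertex h i j c00 c01 , blockVertex h (i - + 1) j c10 c11
ends h (diag a b) with blockType h a b
... | crossB = cross a b , cross a b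
... | mainW  = wrench a b c10 , wrench a b c01
... | antiW  = wrench a b c00 , wrench a b c11

-- e is a boundary edge of face F (for diag this includes that the edge exists)
OnBoundary : (ℤ → ℤ → ℤ) → Edge → ℤ × ℤ → Set
OnBoundary h (hor i j) F = (F ≡ (i , j)) ⊎ (F ≡ (i + + 1 , j))
OnBoundary h (ver i j) F = (F ≡ (i , j)) ⊎ (F ≡ (i , j + + 1))
OnBoundary h (diag a b) F with blockType h a b
... | crossB = ⊥
... | mainW  = (F ≡ cornerFace a b c00) ⊎ (F ≡ cornerFace a b c11)
... | antiW  = (F ≡ cornerFace a b c10) ⊎ (F ≡ cornerFace a b c01)

pyramid : ℤ → ℤ → ℤ → ℤ → ℤ → ℤ
pyramid n0 i0 j0 i j = n0 - + ∣ i - i0 ∣ - + ∣ j - j0 ∣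

ClosedFace : (ℤ → ℤ → ℤ) → ℤ → ℤ → ℤ → ℤ × ℤ → Set
ClosedFace h n0 i0 j0 (i , j) = h i j < pyramid n0 i0 j0 i j

EdgeG : (ℤ → ℤ → ℤ) → ℤ → ℤ → ℤ → Edge → Set
EdgeG h n0 i0 j0 e = ∃ λ F → ClosedFace h n0 i0 j0 F × OnBoundary h e F

Incident : (ℤ → ℤ → ℤ) → Edge → Vtx → Set
Incident h e v = (proj₁ (ends h e) ≡ v) ⊎ (proj₂ (ends h e) ≡ v)

VertexG : (ℤ → ℤ → ℤ) → ℤ → ℤ → ℤ → Vtx → Set
VertexG h n0 i0 j0 v = ∃ λ e → EdgeG h n0 i0 j0 e × Incident h e v

data WalkG (h : ℤ → ℤ → ℤ) (n0 i0 j0 : ℤ) : Vtx → Vtx → Set where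
  here : ∀ {v} → WalkG h n0 i0 j0 v v
  step : ∀ {u w v} (e : Edge) → EdgeG h n0 i0 j0 e →
         ((ends h e ≡ (u , w)) ⊎ (ends h e ≡ (w , u))) →
         WalkG h n0 i0 j0 w v → WalkG h n0 i0 j0 u v

ConnectedG : (ℤ → ℤ → ℤ) → ℤ → ℤ → ℤ → Set
ConnectedG h n0 i0 j0 = ∀ u v → VertexG h n0 i0 j0 u → VertexG h n0 i0 j0 v →
                        WalkG h n0 i0 j0 u v

-- Every vertex of G lies on the boundary of a closed face, and the boundary
-- vertices of a closed face are all joined: consecutive ones either lie on a
-- common lattice edge of the face, or in a common block, where they coincide
-- or (the face being in the equal pair of a wrench) are joined by the diagonal.
-- Lattice-adjacent closed faces share a boundary edge.  Finally h changes by 1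
-- between neighbouring faces while p grows by 1 towards (i0 , j0), so every
-- closed face other than (i0 , j0) has a closed neighbour one step closer to
-- (i0 , j0); chains of such neighbours link all closed faces to the apex.

module Submission where

open import Defs
open import Data.Integer using (ℤ; +_; -[1+_]; _+_; _-_; ∣_∣; _≤_; _<_; -≤+)
open import Data.Integer.Properties
  using ( ≤-refl; +-monoˡ-≤; +-monoˡ-<; ∣i-j∣≡∣j-i∣; ∣i∣≡0⇒i≡0; i-j≡0⇒i≡j; pos-+
        ; module ≤-Reasoning)
open import Data.Integer.Tactic.RingSolver using (solve-∀)
import Data.Nat as ℕ
import Data.Nat.Properties as ℕ
open import Data.Product using (∃; _×_; _,_; proj₁; proj₂; uncurry)
open import Data.Sum using (_⊎_; inj₁; inj₂)
open import Data.Empty using (⊥-elim)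
open import Relation.Binary.PropositionalEquality
  using (_≡_; refl; sym; trans; cong; subst; module ≡-Reasoning)

i+1-1≡i : ∀ i → i + + 1 - + 1 ≡ i
i+1-1≡i = solve-∀

i-1+1≡i : ∀ i → i - + 1 + + 1 ≡ i
i-1+1≡i = solve-∀

i≤∣i∣ : ∀ i → i ≤ + ∣ i ∣
i≤∣i∣ (+ n)    = ≤-refl
i≤∣i∣ -[1+ n ] = -≤+

∣i-j∣≡1⇒i≤j+1 : ∀ i j → ∣ i - j ∣ ≡ 1 → i ≤ j + + 1
∣i-j∣≡1⇒i≤j+1 i j ∣i-j∣≡1 = begin
  i                 ≡⟨ i≡[i-j]+j i j ⟩
  (i - j) + j       ≤⟨ +-monoˡ-≤ j (i≤∣i∣ (i - j)) ⟩
  + ∣ i - j ∣ + j   ≡⟨ cong (λ n → + n + j) ∣i-j∣≡1 ⟩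
  + 1 + j           ≡⟨ 1+j≡j+1 j ⟩
  j + + 1           ∎
  where
  open ≤-Reasoning
  i≡[i-j]+j : ∀ i j → i ≡ (i - j) + j
  i≡[i-j]+j = solve-∀
  1+j≡j+1 : ∀ j → + 1 + j ≡ j + + 1
  1+j≡j+1 = solve-∀

∣i-j∣≡0⇒i≡j : ∀ i j → ∣ i - j ∣ ≡ 0 → i ≡ j
∣i-j∣≡0⇒i≡j i j ∣i-j∣≡0 = i-j≡0⇒i≡j i j (∣i∣≡0⇒i≡0 ∣i-j∣≡0)

∣-[1+n]+1∣≡n : ∀ n → ∣ -[1+ n ] + + 1 ∣ ≡ n
∣-[1+n]+1∣≡n ℕ.zero    = refl
∣-[1+n]+1∣≡n (ℕ.suc n) = refl

stepTowards : ∀ a c {n} → ∣ a - c ∣ ≡ ℕ.suc n →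
              ∃ λ a' → (a' ≡ a + + 1 ⊎ a ≡ a' + + 1) × ∣ a' - c ∣ ≡ n
stepTowards a c far with a - c in a-c
... | + ℕ.zero  = ⊥-elim (ℕ.0≢1+n far)
... | + ℕ.suc m = a - + 1 , inj₂ (sym (i-1+1≡i a)) , (begin
  ∣ a - + 1 - c ∣   ≡⟨ cong ∣_∣ (shift a c) ⟩
  ∣ a - c - + 1 ∣   ≡⟨ cong (λ z → ∣ z - + 1 ∣) a-c ⟩
  m                 ≡⟨ ℕ.suc-injective far ⟩
  _                 ∎)
  where
  open ≡-Reasoning
  shift : ∀ a c → a - + 1 - c ≡ a - c - + 1
  shift = solve-∀
... | -[1+ m ] = a + + 1 , inj₁ refl , (begin
  ∣ a + + 1 - c ∣   ≡⟨ cong ∣_∣ (shift a c) ⟩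
  ∣ a - c + + 1 ∣   ≡⟨ cong (λ z → ∣ z + + 1 ∣) a-c ⟩
  ∣ -[1+ m ] + + 1 ∣ ≡⟨ ∣-[1+n]+1∣≡n m ⟩
  m                 ≡⟨ ℕ.suc-injective far ⟩
  _                 ∎)
  where
  open ≡-Reasoning
  shift : ∀ a c → a + + 1 - c ≡ a - c + + 1
  shift = solve-∀

Adjacent : ℤ × ℤ → ℤ × ℤ → Set
Adjacent (i , j) F = F ≡ (i + + 1 , j) ⊎ F ≡ (i , j + + 1)

Neighbours : ℤ × ℤ → ℤ × ℤ → Set
Neighbours F F' = Adjacent F F' ⊎ Adjacent F' F

module FaceWalks (h : ℤ → ℤ → ℤ) (n0 i0 j0 : ℤ) where

  Walk : Vtx → Vtx → Set
  Walk = WalkG h n0 i0 j0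

  Closed : ℤ × ℤ → Set
  Closed = ClosedFace h n0 i0 j0

  infixr 5 _++_

  _++_ : ∀ {u v w} → Walk u v → Walk v w → Walk u w
  here           ++ q = q
  step e eG o p  ++ q = step e eG o (p ++ q)

  reverse : ∀ {u v} → Walk u v → Walk v u
  reverse here                    = here
  reverse (step e eG (inj₁ o) p)  = reverse p ++ step e eG (inj₂ o) here
  reverse (step e eG (inj₂ o) p)  = reverse p ++ step e eG (inj₁ o) here

  edgeWalk : ∀ e F {u w} → Closed F → OnBoundary h e F → ends h e ≡ (u , w) → Walk u w
  edgeWalk e F cl onF uw = step e (F , cl , onF) (inj₁ uw) here

  sidesAt : Corner → (Corner × Corner) × (Corner × Corner)
  sidesAt c00 = (c00 , c10) , (c00 , c01)
  sidesAt c10 = (c00 , c10) , (c10 , c11)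
  sidesAt c01 = (c00 , c01) , (c01 , c11)
  sidesAt c11 = (c10 , c11) , (c01 , c11)

  side₁ side₂ : ℤ → ℤ → Corner → Vtx
  side₁ a b k = uncurry (blockVertex h a b) (proj₁ (sidesAt k))
  side₂ a b k = uncurry (blockVertex h a b) (proj₂ (sidesAt k))

  -- The two vertices of a block on face k coincide, unless k is in the equal
  -- pair of a wrench, in which case the diagonal of the block joins them.
  cornerWalk : ∀ a b k → Closed (cornerFace a b k) → Walk (side₁ a b k) (side₂ a b k)
  cornerWalk a b k cl
    with blockType h a b | edgeWalk (diag a b) (cornerFace a b k) {side₁ a b k} {side₂ a b k} cl
  cornerWalk a b c00 cl | crossB | _        = here
  cornerWalk a b c00 cl | mainW  | diagonal = diagonal (inj₁ refl) refl
  cornerWalk a b c00 cl | antiW  | _        = here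
  cornerWalk a b c10 cl | crossB | _        = here
  cornerWalk a b c10 cl | mainW  | _        = here
  cornerWalk a b c10 cl | antiW  | diagonal = diagonal (inj₁ refl) refl
  cornerWalk a b c01 cl | crossB | _        = here
  cornerWalk a b c01 cl | mainW  | _        = here
  cornerWalk a b c01 cl | antiW  | diagonal = diagonal (inj₂ refl) refl
  cornerWalk a b c11 cl | crossB | _        = here
  cornerWalk a b c11 cl | mainW  | diagonal = diagonal (inj₂ refl) refl
  cornerWalk a b c11 cl | antiW  | _        = here

  anchor : ℤ × ℤ → Vtx
  anchor (i , j) = blockVertex h i j c00 c10

  -- ends names block (i - 1 , ·) and (· , j - 1), cornerFace names face a + 1:
  -- the two conventions are reconciled by i+1-1≡i and i-1+1≡i.
  sidesBelowReachable : ∀ a b → Closed (a , b + + 1) →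
                        Walk (anchor (a , b + + 1)) (side₁ a b c01) ×
                        Walk (anchor (a , b + + 1)) (side₂ a b c01)
  sidesBelowReachable a b cl = toSide₂ ++ reverse (cornerWalk a b c01 cl) , toSide₂
    where
    toSide₂ : Walk (anchor (a , b + + 1)) (side₂ a b c01)
    toSide₂ = edgeWalk (hor a (b + + 1)) _ cl (inj₁ refl)
                       (cong (anchor (a , b + + 1) ,_)
                             (cong (λ y → blockVertex h a y c01 c11) (i+1-1≡i b)))

  sidesReachable : ∀ {F} a b k → cornerFace a b k ≡ F → Closed F →
                   Walk (anchor F) (side₁ a b k) × Walk (anchor F) (side₂ a b k)
  sidesReachable a b c00 refl cl = here , cornerWalk a b c00 cl
  sidesReachable a b c10 refl cl = toSide₂ ++ reverse (cornerWalk a b c10 cl) , toSide₂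
    where
    toSide₂ : Walk (anchor (a + + 1 , b)) (side₂ a b c10)
    toSide₂ = cornerWalk (a + + 1) b c00 cl
           ++ edgeWalk (ver (a + + 1) b) _ cl (inj₁ refl)
                       (cong (side₂ (a + + 1) b c00 ,_)
                             (cong (λ x → blockVertex h x b c10 c11) (i+1-1≡i a)))
  sidesReachable a b c01 refl cl = sidesBelowReachable a b cl
  sidesReachable a b c11 refl cl = toSide₁ , toSide₁ ++ cornerWalk a b c11 cl
    where
    toSide₁ : Walk (anchor (a + + 1 , b + + 1)) (side₁ a b c11)
    toSide₁ = proj₁ (sidesBelowReachable (a + + 1) b cl)
           ++ edgeWalk (ver (a + + 1) b) _ cl (inj₂ refl)
                       (cong (side₁ (a + + 1) b c01 ,_)
                             (cong (λ x → blockVertex h x b c10 c11) (i+1-1≡i a)))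

  wrenchEqualAt : Corner → BlockType
  wrenchEqualAt c00 = mainW
  wrenchEqualAt c11 = mainW
  wrenchEqualAt c10 = antiW
  wrenchEqualAt c01 = antiW

  diagonalFace : ∀ {a b F} → OnBoundary h (diag a b) F →
                 ∃ λ k → blockType h a b ≡ wrenchEqualAt k × cornerFace a b k ≡ F
  diagonalFace {a} {b} onF with blockType h a b | onF
  ... | mainW | inj₁ F≡ = c00 , refl , sym F≡
  ... | mainW | inj₂ F≡ = c11 , refl , sym F≡
  ... | antiW | inj₁ F≡ = c10 , refl , sym F≡
  ... | antiW | inj₂ F≡ = c01 , refl , sym F≡

  diagonalEnds : ∀ {a b} k → blockType h a b ≡ wrenchEqualAt k →
                 ends h (diag a b) ≡ (side₁ a b k , side₂ a b k)
  diagonalEnds c00 type rewrite type = refl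
  diagonalEnds c10 type rewrite type = refl
  diagonalEnds c01 type rewrite type = refl
  diagonalEnds c11 type rewrite type = refl

  reachEnds : ∀ e {F u w v} → Walk (anchor F) u → Walk (anchor F) w → ends h e ≡ (u , w) →
              Incident h e v → Walk (anchor F) v
  reachEnds _ toU toW refl (inj₁ refl) = toU
  reachEnds _ toU toW refl (inj₂ refl) = toW

  boundaryReach : ∀ e F → Closed F → OnBoundary h e F →
                  ∀ {v} → Incident h e v → Walk (anchor F) v
  boundaryReach (hor i j) _ cl (inj₁ refl) =
    reachEnds (hor i j) (proj₁ (sidesReachable i j c00 refl cl))
                        (proj₂ (sidesReachable i (j - + 1) c01 (cong (i ,_) (i-1+1≡i j)) cl)) refl
  boundaryReach (hor i j) _ cl (inj₂ refl) =
    reachEnds (hor i j) (proj₁ (sidesReachable i j c10 refl cl))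
                        (proj₂ (sidesReachable i (j - + 1) c11 (cong (i + + 1 ,_) (i-1+1≡i j)) cl)) refl
  boundaryReach (ver i j) _ cl (inj₁ refl) =
    reachEnds (ver i j) (proj₂ (sidesReachable i j c00 refl cl))
                        (proj₂ (sidesReachable (i - + 1) j c10 (cong (_, j) (i-1+1≡i i)) cl)) refl
  boundaryReach (ver i j) _ cl (inj₂ refl) =
    reachEnds (ver i j) (proj₁ (sidesReachable i j c01 refl cl))
                        (proj₁ (sidesReachable (i - + 1) j c11 (cong (_, j + + 1) (i-1+1≡i i)) cl)) refl
  boundaryReach (diag a b) _ cl onF with diagonalFace onF
  ... | k , type , refl =
    uncurry (reachEnds (diag a b)) (sidesReachable a b k refl cl) (diagonalEnds k type)

  sharedSide : ∀ {F F'} → Adjacent F F' → ∃ λ e → OnBoundary h e F × OnBoundary h e F'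
  sharedSide {i , j} (inj₁ F'≡) = hor i j , inj₁ refl , inj₂ F'≡
  sharedSide {i , j} (inj₂ F'≡) = ver i j , inj₁ refl , inj₂ F'≡

  adjacentAnchorsJoined : ∀ {F F'} → Adjacent F F' → Closed F → Closed F' →
                          Walk (anchor F) (anchor F')
  adjacentAnchorsJoined adj cl cl' with sharedSide adj
  ... | e , onF , onF' =
    boundaryReach e _ cl onF (inj₁ refl) ++ reverse (boundaryReach e _ cl' onF' (inj₁ refl))

  neighbourAnchorsJoined : ∀ {F F'} → Neighbours F F' → Closed F → Closed F' →
                           Walk (anchor F) (anchor F')
  neighbourAnchorsJoined (inj₁ adj) cl cl' = adjacentAnchorsJoined adj cl cl'
  neighbourAnchorsJoined (inj₂ adj) cl cl' = reverse (adjacentAnchorsJoined adj cl' cl)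

module Connectivity (h : ℤ → ℤ → ℤ) (H : IsHeightFunction h) (n0 i0 j0 : ℤ) where
  open IsHeightFunction H
  open FaceWalks h n0 i0 j0

  height : ℤ × ℤ → ℤ
  height = uncurry h

  dist : ℤ × ℤ → ℕ.ℕ
  dist (i , j) = ∣ i - i0 ∣ ℕ.+ ∣ j - j0 ∣

  pyramid≡n0-dist : ∀ i j → pyramid n0 i0 j0 i j ≡ n0 - + dist (i , j)
  pyramid≡n0-dist i j =
    trans (n-x-y≡n-[x+y] n0 _ _) (cong (n0 -_) (sym (pos-+ ∣ i - i0 ∣ ∣ j - j0 ∣)))
    where
    n-x-y≡n-[x+y] : ∀ n x y → n - x - y ≡ n - (x + y)
    n-x-y≡n-[x+y] = solve-∀

  adjacentHeights : ∀ {F F'} → Adjacent F F' → ∣ height F' - height F ∣ ≡ 1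
  adjacentHeights {i , j} (inj₁ refl) = adjHor i j
  adjacentHeights {i , j} (inj₂ refl) = adjVer i j

  neighbourHeight≤ : ∀ {F F'} → Neighbours F F' → height F' ≤ height F + + 1
  neighbourHeight≤ (inj₁ adj) = ∣i-j∣≡1⇒i≤j+1 _ _ (adjacentHeights adj)
  neighbourHeight≤ {F} {F'} (inj₂ adj) =
    ∣i-j∣≡1⇒i≤j+1 _ _ (trans (∣i-j∣≡∣j-i∣ (height F') (height F)) (adjacentHeights adj))

  closedTowardsApex : ∀ {F F'} → Neighbours F F' → dist F ≡ ℕ.suc (dist F') →
                      Closed F → Closed F'
  closedTowardsApex {i , j} {i' , j'} nb farther cl =
    subst (h i' j' <_) (sym (pyramid≡n0-dist i' j')) (begin-strict
      h i' j'                              ≤⟨ neighbourHeight≤ nb ⟩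
      h i j + + 1                          <⟨ +-monoˡ-< (+ 1) below ⟩
      n0 - + ℕ.suc (dist (i' , j')) + + 1  ≡⟨ n-[1+x]+1≡n-x n0 (+ dist (i' , j')) ⟩
      n0 - + dist (i' , j')                ∎)
    where
    open ≤-Reasoning
    below : h i j < n0 - + ℕ.suc (dist (i' , j'))
    below = subst (λ d → h i j < n0 - + d) farther (subst (h i j <_) (pyramid≡n0-dist i j) cl)
    n-[1+x]+1≡n-x : ∀ n x → n - (+ 1 + x) + + 1 ≡ n - x
    n-[1+x]+1≡n-x = solve-∀

  horizontalNeighbours : ∀ {i i'} j → i' ≡ i + + 1 ⊎ i ≡ i' + + 1 → Neighbours (i , j) (i' , j)
  horizontalNeighbours j (inj₁ i'≡) = inj₁ (inj₁ (cong (_, j) i'≡))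
  horizontalNeighbours j (inj₂ i≡)  = inj₂ (inj₁ (cong (_, j) i≡))

  verticalNeighbours : ∀ i {j j'} → j' ≡ j + + 1 ⊎ j ≡ j' + + 1 → Neighbours (i , j) (i , j')
  verticalNeighbours i (inj₁ j'≡) = inj₁ (inj₂ (cong (i ,_) j'≡))
  verticalNeighbours i (inj₂ j≡)  = inj₂ (inj₂ (cong (i ,_) j≡))

  closerNeighbour : ∀ F {d} → dist F ≡ ℕ.suc d → ∃ λ F' → Neighbours F F' × dist F' ≡ d
  closerNeighbour (i , j) far with ∣ i - i0 ∣ in di
  ... | ℕ.suc _ with stepTowards i i0 di
  ...   | i' , nb , di' =
    (i' , j) , horizontalNeighbours j nb , trans (cong (ℕ._+ ∣ j - j0 ∣) di') (ℕ.suc-injective far)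
  closerNeighbour (i , j) far | ℕ.zero with stepTowards j j0 far
  ...   | j' , nb , dj' = (i , j') , verticalNeighbours i nb , trans (cong (ℕ._+ ∣ j' - j0 ∣) di) dj'

  apexReaches : ∀ d F → dist F ≡ d → Closed F → Walk (anchor (i0 , j0)) (anchor F)
  apexReaches ℕ.zero (i , j) atApex cl
    with ∣i-j∣≡0⇒i≡j i i0 (ℕ.m+n≡0⇒m≡0 _ atApex) | ∣i-j∣≡0⇒i≡j j j0 (ℕ.m+n≡0⇒n≡0 _ atApex)
  ... | refl | refl = here
  apexReaches (ℕ.suc d) F farther cl with closerNeighbour F farther
  ... | F' , nb , closer = apexReaches d F' closer cl' ++ reverse (neighbourAnchorsJoined nb cl cl')
    where
    cl' : Closed F'
    cl' = closedTowardsApex nb (trans farther (cong ℕ.suc (sym closer))) cl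

  vertexReachable : ∀ {v} → VertexG h n0 i0 j0 v → Walk (anchor (i0 , j0)) v
  vertexReachable (e , (F , cl , onF) , incident) =
    apexReaches _ F refl cl ++ boundaryReach e F cl onF incident

-- Membership in 𝒰 only makes the graph nonempty; connectivity holds without it.
mainTheorem5 : (h : ℤ → ℤ → ℤ) → IsHeightFunction h →
               (n0 i0 j0 : ℤ) → InU h n0 i0 j0 → ConnectedG h n0 i0 j0
mainTheorem5 h H n0 i0 j0 _ _ _ u∈G v∈G = reverse (vertexReachable u∈G) ++ vertexReachable v∈G
  where
  open FaceWalks h n0 i0 j0 using (reverse; _++_)
  open Connectivity h H n0 i0 j0 using (vertexReachable)
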